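{- The logic $\mathbf{PM2}$ does not have projective unification: there exists a formula that is unifiable in $\mathbf{PM2}$ but is not projective in $\mathbf{PM2}$ (for instance $\Box x\vee\Box\neg x$).
   Context: $\mathbf{PM2}$ is the normal modal logic (extension of $\mathcal{S}4$) of all finite Kripke frames $\langle\{0,1,\dots,m\},R\rangle$, $m\ge1$, with $xRy\iff(x=0\ \text{or}\ x=y)$. A formula $\varphi(p_1,\dots,p_s)$ is unifiable in a logic $\mathcal{L}$ if some substitution $\sigma$ of formulas for its variables gives $\sigma(\varphi)\in\mathcal{L}$ ($\sigma$ is a unifier). $\varphi$ is projective in $\mathcal{L}$ if there is a unifier $\tau$ of $\varphi$ in $\mathcal{L}$ such that $\Box\varphi\to(p_i\leftrightarrow\tau(p_i))\in\mathcal{L}$ for every variable $p_i$ of $\varphi$ ($\tau$ is then a projective unifier). $\mathcal{L}$ has projective unification if every formula unifiable in $\mathcal{L}$ is projective in $\mathcal{L}$. -}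

module Defs where

open import Data.Nat using (ℕ; suc; _≥_)
open import Data.Fin using (Fin; zero)
open import Data.Bool using (Bool; true)
open import Data.Empty using (⊥)
open import Data.Product using (_×_; Σ)
open import Data.Sum using (_⊎_)
open import Relation.Binary.PropositionalEquality using (_≡_)
open import Relation.Nullary using (¬_)

infixr 5 _⇒_
infixr 6 _∨_
infixr 7 _∧_
data Formula : Set where
  var  : ℕ → Formula
  ⊥′   : Formula
  _⇒_  : Formula → Formula → Formula
  _∧_  : Formula → Formula → Formula
  _∨_  : Formula → Formula → Formula
  ~_   : Formula → Formula
  □_   : Formula → Formula

_⇔_ : Formula → Formula → Formula
φ ⇔ ψ = (φ ⇒ ψ) ∧ (ψ ⇒ φ)

Subst : Set
Subst = ℕ → Formula

_[_] : Formula → Subst → Formula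
var i   [ σ ] = σ i
⊥′      [ σ ] = ⊥′
(φ ⇒ ψ) [ σ ] = (φ [ σ ]) ⇒ (ψ [ σ ])
(φ ∧ ψ) [ σ ] = (φ [ σ ]) ∧ (ψ [ σ ])
(φ ∨ ψ) [ σ ] = (φ [ σ ]) ∨ (ψ [ σ ])
(~ φ)   [ σ ] = ~ (φ [ σ ])
(□ φ)   [ σ ] = □ (φ [ σ ])

data Occurs (i : ℕ) : Formula → Set where
  here : Occurs i (var i)
  ⇒ˡ : ∀ {φ ψ} → Occurs i φ → Occurs i (φ ⇒ ψ)
  ⇒ʳ : ∀ {φ ψ} → Occurs i ψ → Occurs i (φ ⇒ ψ)
  ∧ˡ : ∀ {φ ψ} → Occurs i φ → Occurs i (φ ∧ ψ)
  ∧ʳ : ∀ {φ ψ} → Occurs i ψ → Occurs i (φ ∧ ψ)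
  ∨ˡ : ∀ {φ ψ} → Occurs i φ → Occurs i (φ ∨ ψ)
  ∨ʳ : ∀ {φ ψ} → Occurs i ψ → Occurs i (φ ∨ ψ)
  ~o : ∀ {φ} → Occurs i φ → Occurs i (~ φ)
  □o : ∀ {φ} → Occurs i φ → Occurs i (□ φ)

W : ℕ → Set
W m = Fin (suc m)

R : ∀ {m} → W m → W m → Set
R x y = (x ≡ zero) ⊎ (x ≡ y)

Valuation : ℕ → Set
Valuation m = ℕ → W m → Bool

_,_⊩_ : ∀ {m} → Valuation m → W m → Formula → Set
V , w ⊩ var i   = V i w ≡ true
V , w ⊩ ⊥′      = ⊥
V , w ⊩ (φ ⇒ ψ) = V , w ⊩ φ → V , w ⊩ ψ
V , w ⊩ (φ ∧ ψ) = V , w ⊩ φ × V , w ⊩ ψ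
V , w ⊩ (φ ∨ ψ) = V , w ⊩ φ ⊎ V , w ⊩ ψ
V , w ⊩ (~ φ)   = ¬ (V , w ⊩ φ)
V , w ⊩ (□ φ)   = ∀ v → R w v → V , v ⊩ φ

ValidIn : ℕ → Formula → Set
ValidIn m φ = ∀ (V : Valuation m) (w : W m) → V , w ⊩ φ

PM2 : Formula → Set
PM2 φ = ∀ m → m ≥ 1 → ValidIn m φ

Unifier : (Formula → Set) → Formula → Subst → Set
Unifier L φ σ = L (φ [ σ ])

Unifiable : (Formula → Set) → Formula → Set
Unifiable L φ = Σ Subst (Unifier L φ)

ProjectiveUnifier : (Formula → Set) → Formula → Subst → Set
ProjectiveUnifier L φ τ =
  Unifier L φ τ × (∀ i → Occurs i φ → L (□ φ ⇒ (var i ⇔ τ i)))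

Projective : (Formula → Set) → Formula → Set
Projective L φ = Σ Subst (ProjectiveUnifier L φ)

-- Every world other than the root of F_m sees only itself, so there □x ∨ □¬x holds, and hence so
-- does □(□x ∨ □¬x). Take the valuation on F_2 making x true at world 1 only. A projective unifier
-- τ must then make τ(x) agree with x at both leaves, so τ(x) is true at 1 and false at 2. But τ is
-- a unifier, so □τ(x) ∨ □¬τ(x) holds at the root, which sees both leaves: a contradiction.
module Submission where

open import Defs
open import Data.Bool using (true; false)
open import Data.Bool.Properties using (not-¬)
open import Data.Empty using (⊥-elim)
open import Data.Fin using (Fin; zero; suc)
open import Data.Nat using (ℕ; s≤s; z≤n)
open import Data.Product using (Σ; _×_; _,_; proj₁; proj₂)
open import Data.Sum using (inj₁; inj₂)
open import Relation.Binary.PropositionalEquality using (refl)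
open import Relation.Nullary using (¬_)

boxedDichotomy : ℕ → Formula
boxedDichotomy i = □ var i ∨ □ (~ var i)

boxedDichotomy-unifiable : ∀ i → Unifiable PM2 (boxedDichotomy i)
boxedDichotomy-unifiable i = (λ _ → ⊥′) , λ _ _ _ _ → inj₂ (λ _ _ ())

□-intro-at-leaf : ∀ {m} (V : Valuation m) {k : Fin m} φ → V , suc k ⊩ φ → V , suc k ⊩ (□ φ)
□-intro-at-leaf V φ h _ (inj₂ refl) = h

boxedDichotomy-at-leaf : ∀ {m} (V : Valuation m) (k : Fin m) i → V , suc k ⊩ boxedDichotomy i
boxedDichotomy-at-leaf V k i with V i (suc k) in eq
... | true  = inj₁ (□-intro-at-leaf V (var i) eq)
... | false = inj₂ (□-intro-at-leaf V (~ var i) (not-¬ eq))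

□-or-□¬-at-root⇒constant : ∀ {m} (V : Valuation m) ψ {u v : W m} →
  V , zero ⊩ (□ ψ ∨ □ (~ ψ)) → V , u ⊩ ψ → V , v ⊩ ψ
□-or-□¬-at-root⇒constant V ψ {v = v} (inj₁ always) _  = always v (inj₁ refl)
□-or-□¬-at-root⇒constant V ψ {u = u} (inj₂ never)  hu = ⊥-elim (never u (inj₁ refl) hu)

trueOnlyAt1 : Valuation 2
trueOnlyAt1 _ (suc zero) = true
trueOnlyAt1 _ _          = false

boxedDichotomy-not-projective : ∀ i → ¬ Projective PM2 (boxedDichotomy i)
boxedDichotomy-not-projective i (τ , unifies , agrees) =
  not-¬ refl (proj₂ (x⇔τx-at (suc zero)) τx-at-2)
  where
  x⇔τx-at : ∀ k → trueOnlyAt1 , suc k ⊩ (var i ⇔ τ i)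
  x⇔τx-at k = agrees i (∨ˡ (□o here)) 2 (s≤s z≤n) trueOnlyAt1 (suc k)
    (□-intro-at-leaf trueOnlyAt1 (boxedDichotomy i) (boxedDichotomy-at-leaf trueOnlyAt1 k i))

  τx-at-2 : trueOnlyAt1 , suc (suc zero) ⊩ τ i
  τx-at-2 = □-or-□¬-at-root⇒constant trueOnlyAt1 (τ i) (unifies 2 (s≤s z≤n) trueOnlyAt1 zero)
    (proj₁ (x⇔τx-at zero) refl)

lemma3 : Σ Formula (λ φ → Unifiable PM2 φ × ¬ Projective PM2 φ)
lemma3 = boxedDichotomy 0 , boxedDichotomy-unifiable 0 , boxedDichotomy-not-projective 0
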